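{- The set of maximal bases of $X_n$ is $$\mathbb{B}_{max}(X_n)=\big\{\{b_1,\dots,b_{n-1},x_{2n}\}: b_i\in\{x_{2i},x_{2i+1}\}\text{ for } 1\le i\le n-1\big\},$$ and the set of internal bases is $$\mathbb{B}_-(X_n)=\big\{\{b_1,\dots,b_{n-1},x_{2n-1}\}: b_i\in\{x_{2i-1},x_{2i}\}\text{ for } 1\le i\le n-1\big\}.$$
   Context: Let $(e_i)_{i=1}^n$ be the standard basis of $\mathbb{R}^n$, $e_0:=0$, and $x_{2i-1}=e_i-e_{i-1}$, $x_{2i}=e_i$ for $i=1,\dots,n$ (so $x_1=x_2=e_1$ are distinct elements); $X_n=(x_1\prec x_2\prec\dots\prec x_{2n})$, ordered by index (these are the edges of the broken wheel graph). A basis $B$ is a subset of $X_n$ of $n$ elements forming a basis of $\mathbb{R}^n$. Define $\mathrm{val}(B)=|\{x\in X_n\setminus B:\ \{x\}\cup\{b\in B: b\prec x\}\text{ is linearly independent}\}|$ and $\mathrm{val}^*(B)=|\{b\in B:\ (B\setminus\{b\})\cup\{x\in X_n\setminus B: b\prec x\}\text{ spans }\mathbb{R}^n\}|$. $B$ is maximal if $\mathrm{val}(B)=n$ and internal if $\mathrm{val}^*(B)=n$.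
   Formalization: The coefficient field is ℚ: linear independence and spanning, for bases and for val and val*, are taken in ℚ^n rather than $\mathbb{R}^n$. -}

module Defs where

open import Data.Nat using (ℕ; zero; suc; _∸_; _≤_; _<_; ⌊_/2⌋; ⌈_/2⌉; _%_; _≡ᵇ_)
open import Data.Bool using (Bool; true; false; if_then_else_)
open import Data.Fin using (Fin; toℕ)
open import Data.Fin.Subset using (Subset; _∈_; _∉_; ∣_∣)
open import Data.Rational using (ℚ; 0ℚ; 1ℚ; _*_; _-_; _+_)
open import Data.Product using (Σ; ∃; _×_)
open import Data.Sum using (_⊎_)
open import Relation.Binary.PropositionalEquality using (_≡_; _≢_)
open import Relation.Nullary using (¬_)
open import Function.Bundles using (_⇔_)

sumFin : ∀ {m} → (Fin m → ℚ) → ℚ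
sumFin {zero}  f = 0ℚ
sumFin {suc m} f = f Data.Fin.zero + sumFin (λ k → f (Data.Fin.suc k))

-- Standard basis vector e_i of ℚ^n (1-based i; e_0 = 0).  Coordinate j : Fin n is e_{toℕ j + 1}.
e : (n : ℕ) → ℕ → Fin n → ℚ
e n i j = if (suc (toℕ j) ≡ᵇ i) then 1ℚ else 0ℚ

-- The vector x_p (paper 1-based index p): x_{2i-1} = e_i - e_{i-1}, x_{2i} = e_i.
xvec : (n : ℕ) → ℕ → Fin n → ℚ
xvec n p j = if (p % 2 ≡ᵇ 0) then e n ⌊ p /2⌋ j else (e n ⌈ p /2⌉ j - e n ⌊ p /2⌋ j)

-- Elements of X_n are indexed by k : Fin (2 * n); k stands for x_{toℕ k + 1}.
pidx : ∀ {m} → Fin m → ℕ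
pidx k = suc (toℕ k)

_≺_ : ∀ {m} → Fin m → Fin m → Set
k ≺ k' = toℕ k < toℕ k'

combo : (n : ℕ) → (Fin (2 Data.Nat.* n) → ℚ) → Fin n → ℚ
combo n c j = sumFin (λ k → c k * xvec n (pidx k) j)

Supported : (n : ℕ) → (Fin (2 Data.Nat.* n) → Set) → (Fin (2 Data.Nat.* n) → ℚ) → Set
Supported n P c = ∀ k → ¬ P k → c k ≡ 0ℚ

LinIndep : (n : ℕ) → (Fin (2 Data.Nat.* n) → Set) → Set
LinIndep n P = ∀ c → Supported n P c → (∀ j → combo n c j ≡ 0ℚ) → ∀ k → c k ≡ 0ℚ

Spans : (n : ℕ) → (Fin (2 Data.Nat.* n) → Set) → Set
Spans n P = ∀ (v : Fin n → ℚ) → ∃ λ c → Supported n P c × (∀ j → combo n c j ≡ v j)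

IsBasis : (n : ℕ) → Subset (2 Data.Nat.* n) → Set
IsBasis n B = ∣ B ∣ ≡ n × LinIndep n (_∈ B) × Spans n (_∈ B)

HasCard : ∀ {m} → (Fin m → Set) → ℕ → Set
HasCard {m} P c = Σ (Subset m) λ S → (∀ k → (k ∈ S) ⇔ P k) × ∣ S ∣ ≡ c

ValSet : (n : ℕ) → Subset (2 Data.Nat.* n) → Fin (2 Data.Nat.* n) → Set
ValSet n B x = x ∉ B × LinIndep n (λ k → k ≡ x ⊎ (k ∈ B × k ≺ x))

ValStarSet : (n : ℕ) → Subset (2 Data.Nat.* n) → Fin (2 Data.Nat.* n) → Set
ValStarSet n B b = b ∈ B × Spans n (λ k → (k ∈ B × k ≢ b) ⊎ (k ∉ B × b ≺ k))

val≡ : (n : ℕ) → Subset (2 Data.Nat.* n) → ℕ → Set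
val≡ n B c = HasCard (ValSet n B) c

val*≡ : (n : ℕ) → Subset (2 Data.Nat.* n) → ℕ → Set
val*≡ n B c = HasCard (ValStarSet n B) c

Maximal : (n : ℕ) → Subset (2 Data.Nat.* n) → Set
Maximal n B = val≡ n B n

Internal : (n : ℕ) → Subset (2 Data.Nat.* n) → Set
Internal n B = val*≡ n B n

MaxForm : (n : ℕ) → Subset (2 Data.Nat.* n) → Set
MaxForm n B = Σ (ℕ → Bool) λ s → ∀ k → (k ∈ B) ⇔
  (pidx k ≡ 2 Data.Nat.* n ⊎
   Σ ℕ λ i → 1 ≤ i × i ≤ n ∸ 1 × pidx k ≡ (if s i then 2 Data.Nat.* i else suc (2 Data.Nat.* i)))

IntForm : (n : ℕ) → Subset (2 Data.Nat.* n) → Set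
IntForm n B = Σ (ℕ → Bool) λ s → ∀ k → (k ∈ B) ⇔
  (pidx k ≡ 2 Data.Nat.* n ∸ 1 ⊎
   Σ ℕ λ i → 1 ≤ i × i ≤ n ∸ 1 × pidx k ≡ (if s i then 2 Data.Nat.* i ∸ 1 else 2 Data.Nat.* i))

-- Index X_n by positions p = 0, …, 2n-1 (p stands for x_{p+1}); coordinate j of Σ C_p x_{p+1} is then
-- C(2j) + C(2j+1) - C(2j+2), so coefficient equations can be solved one coordinate at a time.
--
-- For the stated forms this triangular structure gives independence and spanning directly: maximal
-- bases are solved from the first coordinate upwards, internal ones from the last downwards.  The same
-- elimination shows that each x ∉ B is counted by val (for maximal B), while for internal B the
-- val*-family of b ∈ B spans after flipping the pair of b, or using x_{2j+2} + x_{2j+3} = x_{2j+4}.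
--
-- Conversely, let B be a basis.  If B is maximal, then x_1 ∉ B and not both x_{2j+2}, x_{2j+3} ∈ B,
-- since the relations x_1 = x_2 and x_{2j+2} + x_{2j+3} = x_{2j+4} would otherwise live in B or in a
-- val-family; and x_{2n} ∈ B, as otherwise its val-family would be an independent extension of the
-- spanning set B.  If B is internal, then x_{2n} ∉ B for the same reason, and every pair
-- {x_{2j+1}, x_{2j+2}} meets B: otherwise the val*-family of the next element of B misses coordinate j.
-- Since |B| = n, these bounds force exactly one element of B in each pair.

module Submission where

open import Defs
open import Data.Nat using (ℕ; _≤_)
open import Data.Fin.Subset using (Subset)
open import Data.Product using (_×_)
open import Function.Bundles using (_⇔_)

open import Data.Bool using (Bool; true; false; if_then_else_; not; T)
open import Data.Bool.Properties using (¬-not; not-¬; if-cong; not-involutive; not-injective)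
open import Data.Empty using (⊥; ⊥-elim)
open import Data.Fin as F using (Fin; toℕ; fromℕ<)
import Data.Fin.Properties as FP
open import Data.Fin.Subset using (_∈_; _∉_; ∁; ∣_∣)
open import Data.Fin.Subset.Properties
  using (_∈?_; p⊂q⇒∣p∣<∣q∣; ∣∁p∣≡n∸∣p∣; x∈∁p⇒x∉p; x∉p⇒x∈∁p)
open import Data.Nat as N using (zero; suc; _<_; z≤n; s≤s; _≡ᵇ_; _∸_; ⌊_/2⌋)
import Data.Nat.Properties as NP
open import Data.Product using (Σ; ∃; _,_; proj₁; proj₂)
open import Data.Rational using (ℚ; 0ℚ; 1ℚ; _+_; _*_; _-_)
import Data.Rational.Properties as QP
open import Data.Rational.Solver using (module +-*-Solver)
open import Data.Sum using (_⊎_; inj₁; inj₂)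
open import Data.Unit using (tt)
open import Data.Vec using ([]; _∷_; lookup)
import Data.Vec.Properties as VP
open import Function.Base using (_∘_)
open import Function.Bundles using (mk⇔; Equivalence)
import Function.Properties.Equivalence as ⇔
open import Relation.Binary.PropositionalEquality
open import Relation.Nullary using (¬_; yes; no; contradiction)

open import Algebra.Properties.Group QP.+-0-group using (x∙y⁻¹≈ε⇒x≈y)
open +-*-Solver using (solve; _:+_; _:*_; _:-_; _:=_; con)

double : ℕ → ℕ
double zero    = zero
double (suc n) = suc (suc (double n))

2*≡double : ∀ n → 2 N.* n ≡ double n
2*≡double zero    = refl
2*≡double (suc n) = cong suc (trans (NP.+-suc n (n N.+ 0)) (cong suc (2*≡double n)))

double-cancel-< : ∀ {a b} → double a < double b → a < b
double-cancel-< {zero}  {suc b} _               = s≤s z≤n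
double-cancel-< {suc a} {suc b} (s≤s (s≤s lt)) = s≤s (double-cancel-< lt)

suc-double<double : ∀ {a b} → a < b → suc (double a) < double b
suc-double<double {zero}  {suc b} _        = s≤s (s≤s z≤n)
suc-double<double {suc a} {suc b} (s≤s lt) = s≤s (s≤s (suc-double<double lt))

double-injective : ∀ {a b} → double a ≡ double b → a ≡ b
double-injective {zero}  {zero}  _  = refl
double-injective {suc a} {suc b} eq = cong suc (double-injective (NP.suc-injective (NP.suc-injective eq)))

double≢suc-double : ∀ {a b} → double a ≢ suc (double b)
double≢suc-double {suc a} {suc b} eq = double≢suc-double (NP.suc-injective (NP.suc-injective eq))

data Parity : ℕ → Set where
  even : ∀ j → Parity (double j)
  odd  : ∀ j → Parity (suc (double j))

parity : ∀ p → Parity p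
parity zero          = even 0
parity (suc zero)    = odd 0
parity (suc (suc p)) with parity p
... | even j = even (suc j)
... | odd j  = odd (suc j)

⌊double/2⌋ : ∀ j → ⌊ double j /2⌋ ≡ j
⌊double/2⌋ zero    = refl
⌊double/2⌋ (suc j) = cong suc (⌊double/2⌋ j)

⌊suc-double/2⌋ : ∀ j → ⌊ suc (double j) /2⌋ ≡ j
⌊suc-double/2⌋ zero    = refl
⌊suc-double/2⌋ (suc j) = cong suc (⌊suc-double/2⌋ j)

⌊/2⌋≡⇒ : ∀ {p j} → ⌊ p /2⌋ ≡ j → p ≡ double j ⊎ p ≡ suc (double j)
⌊/2⌋≡⇒ {p} eq with parity p
... | even i = inj₁ (cong double (trans (sym (⌊double/2⌋ i)) eq))
... | odd i  = inj₂ (cong (suc ∘ double) (trans (sym (⌊suc-double/2⌋ i)) eq))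

true⇒< : ∀ {f : ℕ → Bool} {L p} → (∀ q → L ≤ q → f q ≡ false) → f p ≡ true → p < L
true⇒< {L = L} {p} bounded fp with p N.<? L
... | yes p<L = p<L
... | no  p≮L = contradiction fp (not-¬ (bounded p (NP.≮⇒≥ p≮L)))

not-swap : ∀ {x y} → x ≡ not y → y ≡ not x
not-swap {y = y} x≡¬y = trans (sym (not-involutive y)) (cong not (sym x≡¬y))

bool-ext : ∀ {x y} → (x ≡ true) ⇔ (y ≡ true) → x ≡ y
bool-ext {true}  {true}  _ = refl
bool-ext {true}  {false} h = sym (Equivalence.to h refl)
bool-ext {false} {true}  h = Equivalence.from h refl
bool-ext {false} {false} _ = refl

≡not⇒⇔ : ∀ {x y} → x ≡ not y → (x ≡ true) ⇔ (y ≡ false)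
≡not⇒⇔ {y = true}  refl = mk⇔ (λ ()) (λ ())
≡not⇒⇔ {y = false} refl = mk⇔ (λ _ → refl) (λ _ → refl)

OnePerPair : ℕ → (ℕ → Bool) → Set
OnePerPair m f = ∀ j → j < m → f (double j) ≡ not (f (suc (double j)))

AtMostOnePerPair AtLeastOnePerPair : ℕ → (ℕ → Bool) → Set
AtMostOnePerPair  m f = ∀ j → j < m → f (double j) ≡ true  → f (suc (double j)) ≡ false
AtLeastOnePerPair m f = ∀ j → j < m → f (double j) ≡ false → f (suc (double j)) ≡ true

OnePerPair-cons : ∀ {m f} → f 0 ≡ not (f 1) → OnePerPair m (f ∘ suc ∘ suc) → OnePerPair (suc m) f
OnePerPair-cons first rest zero    _        = first
OnePerPair-cons first rest (suc j) (s≤s lt) = rest j lt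

OnePerPair-snoc : ∀ {m f} → OnePerPair m f → f (double m) ≡ not (f (suc (double m))) → OnePerPair (suc m) f
OnePerPair-snoc pairs last j lt with NP.m≤n⇒m<n∨m≡n (NP.≤-pred lt)
... | inj₁ j<m  = pairs j j<m
... | inj₂ refl = last

flipPair : ℕ → (ℕ → Bool) → ℕ → Bool
flipPair i f p = if ⌊ p /2⌋ ≡ᵇ i then not (f p) else f p

OnePerPair-flipPair : ∀ {m f} i → OnePerPair m f → OnePerPair m (flipPair i f)
OnePerPair-flipPair i pairs j lt rewrite ⌊double/2⌋ j | ⌊suc-double/2⌋ j with j ≡ᵇ i
... | true  = cong not (pairs j lt)
... | false = pairs j lt

count : (ℕ → Bool) → ℕ → ℕ
count f zero    = zero
count f (suc L) = if f 0 then suc (count (f ∘ suc) L) else count (f ∘ suc) L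

count-last : ∀ f L → f L ≡ true → count f (suc L) ≡ suc (count f L)
count-last f zero    fL = cong (λ b → if b then 1 else 0) fL
count-last f (suc L) fL with f 0
... | true  = cong suc (count-last (f ∘ suc) L fL)
... | false = count-last (f ∘ suc) L fL

count-≤ : ∀ m f → AtMostOnePerPair m f → count f (double m) ≤ m
count-≤ zero    f atMost = z≤n
count-≤ (suc m) f atMost with f 0 in e₀ | f 1 in e₁
... | true  | true  = contradiction (trans (sym e₁) (atMost 0 (s≤s z≤n) e₀)) (λ ())
... | true  | false = s≤s (count-≤ m (f ∘ suc ∘ suc) (λ j lt → atMost (suc j) (s≤s lt)))
... | false | true  = s≤s (count-≤ m (f ∘ suc ∘ suc) (λ j lt → atMost (suc j) (s≤s lt)))
... | false | false = NP.m≤n⇒m≤1+n (count-≤ m (f ∘ suc ∘ suc) (λ j lt → atMost (suc j) (s≤s lt)))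

count-≥ : ∀ m f → AtLeastOnePerPair m f → m ≤ count f (double m)
count-≥ zero    f atLeast = z≤n
count-≥ (suc m) f atLeast with f 0 in e₀ | f 1 in e₁
... | false | false = contradiction (trans (sym (atLeast 0 (s≤s z≤n) e₀)) e₁) (λ ())
... | true  | false = s≤s (count-≥ m (f ∘ suc ∘ suc) (λ j lt → atLeast (suc j) (s≤s lt)))
... | false | true  = s≤s (count-≥ m (f ∘ suc ∘ suc) (λ j lt → atLeast (suc j) (s≤s lt)))
... | true  | true  = NP.m≤n⇒m≤1+n (s≤s (count-≥ m (f ∘ suc ∘ suc) (λ j lt → atLeast (suc j) (s≤s lt))))

count-≤-tight : ∀ m f → AtMostOnePerPair m f → count f (double m) ≡ m → OnePerPair m f
count-≤-tight zero    f atMost total = λ _ ()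
count-≤-tight (suc m) f atMost total with f 0 in e₀ | f 1 in e₁
... | true  | true  = contradiction (trans (sym e₁) (atMost 0 (s≤s z≤n) e₀)) (λ ())
... | false | false = contradiction (subst (_≤ m) total (count-≤ m _ atMost′)) NP.1+n≰n
  where atMost′ = λ j lt → atMost (suc j) (s≤s lt)
... | true  | false = OnePerPair-cons {m} {f} (trans e₀ (cong not (sym e₁)))
                        (count-≤-tight m _ (λ j lt → atMost (suc j) (s≤s lt)) (NP.suc-injective total))
... | false | true  = OnePerPair-cons {m} {f} (trans e₀ (cong not (sym e₁)))
                        (count-≤-tight m _ (λ j lt → atMost (suc j) (s≤s lt)) (NP.suc-injective total))

count-≥-tight : ∀ m f → AtLeastOnePerPair m f → count f (double m) ≡ m → OnePerPair m f
count-≥-tight zero    f atLeast total = λ _ ()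
count-≥-tight (suc m) f atLeast total with f 0 in e₀ | f 1 in e₁
... | false | false = contradiction (trans (sym (atLeast 0 (s≤s z≤n) e₀)) e₁) (λ ())
... | true  | true  = contradiction (subst (suc m ≤_) (NP.suc-injective total) (s≤s (count-≥ m _ atLeast′)))
                        NP.1+n≰n
  where atLeast′ = λ j lt → atLeast (suc j) (s≤s lt)
... | true  | false = OnePerPair-cons {m} {f} (trans e₀ (cong not (sym e₁)))
                        (count-≥-tight m _ (λ j lt → atLeast (suc j) (s≤s lt)) (NP.suc-injective total))
... | false | true  = OnePerPair-cons {m} {f} (trans e₀ (cong not (sym e₁)))
                        (count-≥-tight m _ (λ j lt → atLeast (suc j) (s≤s lt)) (NP.suc-injective total))

count-one-per-pair : ∀ m f → OnePerPair m f → count f (double m) ≡ m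
count-one-per-pair m f pairs = NP.≤-antisym
  (count-≤ m f (λ j lt fj → trans (not-swap (pairs j lt)) (cong not fj)))
  (count-≥ m f (λ j lt fj → trans (not-swap (pairs j lt)) (cong not fj)))

-- Coordinates of linear combinations

δ : ℕ → ℕ → ℚ
δ p q = if p ≡ᵇ q then 1ℚ else 0ℚ

δ-refl : ∀ p → δ p p ≡ 1ℚ
δ-refl zero    = refl
δ-refl (suc p) = δ-refl p

δ-≢ : ∀ {p q} → p ≢ q → δ p q ≡ 0ℚ
δ-≢ {zero}  {zero}  ne = ⊥-elim (ne refl)
δ-≢ {zero}  {suc q} ne = refl
δ-≢ {suc p} {zero}  ne = refl
δ-≢ {suc p} {suc q} ne = δ-≢ (ne ∘ cong suc)

-- Position p stands for x_{p+1} and coordinate j for e_{j+1}: the vectors with a nonzero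
-- j-th coordinate are x_{2j+1} = e_{j+1} - e_j and x_{2j+2} = e_{j+1} (entry 1) and
-- x_{2j+3} = e_{j+2} - e_{j+1} (entry -1).
lincomb : (ℕ → ℚ) → ℕ → ℚ
lincomb C j = (C (double j) + C (suc (double j))) - C (suc (suc (double j)))

lincomb-cong : ∀ {C D : ℕ → ℚ} → (∀ p → C p ≡ D p) → ∀ j → lincomb C j ≡ lincomb D j
lincomb-cong eq j = cong₂ _-_ (cong₂ _+_ (eq _) (eq _)) (eq _)

lincomb-sub : ∀ (C D : ℕ → ℚ) j → lincomb (λ p → C p - D p) j ≡ lincomb C j - lincomb D j
lincomb-sub C D j = solve 6 (λ a b c a′ b′ c′ → ((a :- a′) :+ (b :- b′)) :- (c :- c′) :=
                                ((a :+ b) :- c) :- ((a′ :+ b′) :- c′)) refl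
                      (C (double j)) (C (suc (double j))) (C (suc (suc (double j))))
                      (D (double j)) (D (suc (double j))) (D (suc (suc (double j))))

lincomb-sub-scaled : ∀ (C D : ℕ → ℚ) g j →
  lincomb (λ p → C p - g * D p) j ≡ lincomb C j - g * lincomb D j
lincomb-sub-scaled C D g j =
  solve 7 (λ g a b c a′ b′ c′ → ((a :- g :* a′) :+ (b :- g :* b′)) :- (c :- g :* c′) :=
                                ((a :+ b) :- c) :- g :* ((a′ :+ b′) :- c′)) refl
          g (C (double j)) (C (suc (double j))) (C (suc (suc (double j))))
          (D (double j)) (D (suc (double j))) (D (suc (suc (double j))))

lincomb≡0⇒sum≡next : ∀ C j → lincomb C j ≡ 0ℚ →
  C (double j) + C (suc (double j)) ≡ C (suc (suc (double j)))
lincomb≡0⇒sum≡next C j = x∙y⁻¹≈ε⇒x≈y _ _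

lincomb≡0⇒first≡0 : ∀ C j → lincomb C j ≡ 0ℚ →
  C (suc (double j)) ≡ 0ℚ → C (suc (suc (double j))) ≡ 0ℚ → C (double j) ≡ 0ℚ
lincomb≡0⇒first≡0 C j rel b≡0 c≡0 = begin
  C (double j)                              ≡⟨ QP.+-identityʳ _ ⟨
  C (double j) + 0ℚ                         ≡⟨ cong (C (double j) +_) b≡0 ⟨
  C (double j) + C (suc (double j))         ≡⟨ lincomb≡0⇒sum≡next C j rel ⟩
  C (suc (suc (double j)))                  ≡⟨ c≡0 ⟩
  0ℚ                                        ∎
  where open ≡-Reasoning

extend : ∀ {m} → (Fin m → ℚ) → ℕ → ℚ
extend {zero}  c p       = 0ℚ
extend {suc m} c zero    = c F.zero
extend {suc m} c (suc p) = extend (c ∘ F.suc) p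

extend-toℕ : ∀ {m} (c : Fin m → ℚ) k → extend c (toℕ k) ≡ c k
extend-toℕ c F.zero    = refl
extend-toℕ c (F.suc k) = extend-toℕ (c ∘ F.suc) k

extend-zero : ∀ {m} (c : Fin m → ℚ) p → (∀ k → toℕ k ≡ p → c k ≡ 0ℚ) → extend c p ≡ 0ℚ
extend-zero {zero}  c p       h = refl
extend-zero {suc m} c zero    h = h F.zero refl
extend-zero {suc m} c (suc p) h = extend-zero (c ∘ F.suc) p (λ k eq → h (F.suc k) (cong suc eq))

extend-restrict : ∀ {m} (C : ℕ → ℚ) → (∀ p → m ≤ p → C p ≡ 0ℚ) →
  ∀ p → extend {m} (C ∘ toℕ) p ≡ C p
extend-restrict {zero}  C van p       = sym (van p z≤n)
extend-restrict {suc m} C van zero    = refl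
extend-restrict {suc m} C van (suc p) = extend-restrict (C ∘ suc) (λ q le → van (suc q) (s≤s le)) p

xvec-δ : ∀ {n} p (j : Fin n) → let J = toℕ j in
  xvec n (suc p) j ≡ (δ p (double J) + δ p (suc (double J))) - δ p (suc (suc (double J)))
xvec-δ 0 F.zero                  = refl
xvec-δ 0 (F.suc j)               = refl
xvec-δ 1 F.zero                  = refl
xvec-δ 1 (F.suc j)               = refl
xvec-δ 2 F.zero                  = refl
xvec-δ 3 F.zero                  = refl
xvec-δ (suc (suc (suc (suc p)))) F.zero with suc p N.% 2 ≡ᵇ 0
... | true  = refl
... | false = refl
xvec-δ (suc (suc p)) (F.suc j)   = xvec-δ p j

sumFin-cong : ∀ {m} {f g : Fin m → ℚ} → (∀ k → f k ≡ g k) → sumFin f ≡ sumFin g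
sumFin-cong {zero}  eq = refl
sumFin-cong {suc m} eq = cong₂ _+_ (eq F.zero) (sumFin-cong (eq ∘ F.suc))

sumFin-δ : ∀ {m} (c : Fin m → ℚ) q → sumFin (λ k → c k * δ (toℕ k) q) ≡ extend c q
sumFin-δ {zero}  c q       = refl
sumFin-δ {suc m} c zero    = begin
  c F.zero * 1ℚ + sumFin (λ k → c (F.suc k) * 0ℚ)
    ≡⟨ cong₂ _+_ (QP.*-identityʳ (c F.zero)) (sumFin-zero (QP.*-zeroʳ ∘ c ∘ F.suc)) ⟩
  c F.zero + 0ℚ
    ≡⟨ QP.+-identityʳ (c F.zero) ⟩
  c F.zero ∎
  where
  open ≡-Reasoning
  sumFin-zero : ∀ {m} {f : Fin m → ℚ} → (∀ k → f k ≡ 0ℚ) → sumFin f ≡ 0ℚ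
  sumFin-zero {zero}  h = refl
  sumFin-zero {suc m} h = trans (cong₂ _+_ (h F.zero) (sumFin-zero (h ∘ F.suc))) (QP.+-identityʳ 0ℚ)
sumFin-δ {suc m} c (suc q) =
  trans (cong₂ _+_ (QP.*-zeroʳ (c F.zero)) (sumFin-δ (c ∘ F.suc) q)) (QP.+-identityˡ _)

sumFin-distrib-lincomb : ∀ {m} (c u v w : Fin m → ℚ) →
  sumFin (λ k → c k * ((u k + v k) - w k)) ≡
  (sumFin (λ k → c k * u k) + sumFin (λ k → c k * v k)) - sumFin (λ k → c k * w k)
sumFin-distrib-lincomb {zero}  c u v w = refl
sumFin-distrib-lincomb {suc m} c u v w =
  trans (cong (c F.zero * ((u F.zero + v F.zero) - w F.zero) +_)
              (sumFin-distrib-lincomb (c ∘ F.suc) (u ∘ F.suc) (v ∘ F.suc) (w ∘ F.suc)))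
        (solve 7 (λ c u v w U V W → c :* ((u :+ v) :- w) :+ ((U :+ V) :- W) :=
                   ((c :* u :+ U) :+ (c :* v :+ V)) :- (c :* w :+ W)) refl
                   (c F.zero) (u F.zero) (v F.zero) (w F.zero) _ _ _)

combo≡lincomb : ∀ n c (j : Fin n) → combo n c j ≡ lincomb (extend c) (toℕ j)
combo≡lincomb n c j = begin
  combo n c j
    ≡⟨ sumFin-cong (λ k → cong (c k *_) (xvec-δ (toℕ k) j)) ⟩
  sumFin (λ k → c k * ((δ (toℕ k) a + δ (toℕ k) b) - δ (toℕ k) d))
    ≡⟨ sumFin-distrib-lincomb c _ _ _ ⟩
  (sumFin (λ k → c k * δ (toℕ k) a) + sumFin (λ k → c k * δ (toℕ k) b)) - sumFin (λ k → c k * δ (toℕ k) d)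
    ≡⟨ cong₂ _-_ (cong₂ _+_ (sumFin-δ c a) (sumFin-δ c b)) (sumFin-δ c d) ⟩
  lincomb (extend c) (toℕ j) ∎
  where
  open ≡-Reasoning
  a = double (toℕ j)
  b = suc a
  d = suc b

-- Independence and spanning for families of positions

Supportedℕ : (ℕ → Set) → (ℕ → ℚ) → Set
Supportedℕ Q C = ∀ p → ¬ Q p → C p ≡ 0ℚ

Relationℕ : ℕ → (ℕ → ℚ) → Set
Relationℕ n C = ∀ j → j < n → lincomb C j ≡ 0ℚ

LinIndepℕ : ℕ → (ℕ → Set) → Set
LinIndepℕ n Q = ∀ C → Supportedℕ Q C → Relationℕ n C → ∀ p → C p ≡ 0ℚ

Spansℕ : ℕ → (ℕ → Set) → Set
Spansℕ n Q = ∀ (v : ℕ → ℚ) → ∃ λ C → Supportedℕ Q C × (∀ j → j < n → lincomb C j ≡ v j)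

record Represents (n : ℕ) (P : Fin (2 N.* n) → Set) (Q : ℕ → Set) : Set where
  field
    represents : ∀ k → P k ⇔ Q (toℕ k)
    bounded    : ∀ p → Q p → p < double n

module _ {n} {P : Fin (2 N.* n) → Set} {Q : ℕ → Set} (R : Represents n P Q) where
  open Represents R

  private
    vanishing : ∀ {C} → Supportedℕ Q C → ∀ p → 2 N.* n ≤ p → C p ≡ 0ℚ
    vanishing sup p le = sup p (λ q → NP.<⇒≱ (bounded p q) (subst (_≤ p) (2*≡double n) le))

    restrict-supported : ∀ {C} → Supportedℕ Q C → Supported n P (C ∘ toℕ)
    restrict-supported sup k ¬Pk = sup (toℕ k) (¬Pk ∘ Equivalence.from (represents k))

    extend-supported : ∀ {c} → Supported n P c → Supportedℕ Q (extend c)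
    extend-supported {c} sup p ¬Qp =
      extend-zero c p (λ k eq → sup k (λ Pk → ¬Qp (subst Q eq (Equivalence.to (represents k) Pk))))

    combo-restrict : ∀ {C} → Supportedℕ Q C → ∀ j → combo n (C ∘ toℕ) j ≡ lincomb C (toℕ j)
    combo-restrict {C} sup j =
      trans (combo≡lincomb n (C ∘ toℕ) j) (lincomb-cong (extend-restrict {2 N.* n} C (vanishing sup)) (toℕ j))

    combo-fromℕ< : ∀ c {j} (lt : j < n) → combo n c (fromℕ< lt) ≡ lincomb (extend c) j
    combo-fromℕ< c lt = trans (combo≡lincomb n c _) (cong (lincomb (extend c)) (FP.toℕ-fromℕ< lt))

  LinIndep⇔LinIndepℕ : LinIndep n P ⇔ LinIndepℕ n Q
  LinIndep⇔LinIndepℕ = mk⇔ to from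
    where
    to : LinIndep n P → LinIndepℕ n Q
    to li C sup rel p = begin
      C p                          ≡⟨ extend-restrict {2 N.* n} C (vanishing sup) p ⟨
      extend {2 N.* n} (C ∘ toℕ) p ≡⟨ extend-zero (C ∘ toℕ) p (λ k _ → restriction-zero k) ⟩
      0ℚ                           ∎
      where
      open ≡-Reasoning
      restriction-zero : ∀ k → C (toℕ k) ≡ 0ℚ
      restriction-zero = li (C ∘ toℕ) (restrict-supported {C} sup)
                            (λ j → trans (combo-restrict {C} sup j) (rel (toℕ j) (FP.toℕ<n j)))
    from : LinIndepℕ n Q → LinIndep n P
    from li c sup zero-combo k = trans (sym (extend-toℕ c k))
      (li (extend c) (extend-supported {c} sup)
          (λ j lt → trans (sym (combo-fromℕ< c lt)) (zero-combo _)) (toℕ k))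

  Spans⇔Spansℕ : Spans n P ⇔ Spansℕ n Q
  Spans⇔Spansℕ = mk⇔ to from
    where
    to : Spans n P → Spansℕ n Q
    to sp v with sp (v ∘ toℕ)
    ... | c , sup , eq = extend c , extend-supported {c} sup ,
          λ j lt → trans (sym (combo-fromℕ< c lt)) (trans (eq (fromℕ< lt)) (cong v (FP.toℕ-fromℕ< lt)))
    from : Spansℕ n Q → Spans n P
    from sp v with sp (extend v)
    ... | C , sup , eq = C ∘ toℕ , restrict-supported {C} sup ,
          λ j → trans (combo-restrict {C} sup j) (trans (eq (toℕ j) (FP.toℕ<n j)) (extend-toℕ v j))

VanishesFrom : ℕ → (ℕ → ℚ) → Set
VanishesFrom m C = ∀ p → m ≤ p → C p ≡ 0ℚ

equal⇒both-zero : ∀ {a b : ℚ} → a ≡ b → a ≡ 0ℚ ⊎ b ≡ 0ℚ → a ≡ 0ℚ × b ≡ 0ℚ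
equal⇒both-zero a≡b (inj₁ a≡0) = a≡0 , trans (sym a≡b) a≡0
equal⇒both-zero a≡b (inj₂ b≡0) = trans a≡b b≡0 , b≡0

sum-zero⇒both-zero : ∀ {a b : ℚ} → a + b ≡ 0ℚ → a ≡ 0ℚ ⊎ b ≡ 0ℚ → a ≡ 0ℚ × b ≡ 0ℚ
sum-zero⇒both-zero {b = b} a+b≡0 (inj₁ a≡0) =
  a≡0 , trans (sym (QP.+-identityˡ b)) (trans (cong (_+ b) (sym a≡0)) a+b≡0)
sum-zero⇒both-zero {a = a} a+b≡0 (inj₂ b≡0) =
  trans (sym (QP.+-identityʳ a)) (trans (cong (a +_) (sym b≡0)) a+b≡0) , b≡0

one-of-pair-zero : ∀ {f : ℕ → Bool} {C : ℕ → ℚ} {a b : ℕ} →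
  Supportedℕ (λ p → f p ≡ true) C → f a ≡ not (f b) → C a ≡ 0ℚ ⊎ C b ≡ 0ℚ
one-of-pair-zero {f} {a = a} {b} sup fa≡¬fb with f a in e
... | false = inj₁ (sup a (λ fa → contradiction (trans (sym e) fa) (λ ())))
... | true  = inj₂ (sup b (λ fb → contradiction (trans fa≡¬fb (cong not fb)) (λ ())))

-- Going up: C(2j) = 0 and coordinate j force C(2j+1) = C(2j+2), so both vanish.
relation-vanishes-upward : ∀ n C → Relationℕ n C → VanishesFrom (double n) C → C 0 ≡ 0ℚ →
  (∀ j → j < n → C (suc (double j)) ≡ 0ℚ ⊎ C (suc (suc (double j))) ≡ 0ℚ) → ∀ p → C p ≡ 0ℚ
relation-vanishes-upward zero    C rel van C0 pairs p = van p z≤n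
relation-vanishes-upward (suc n) C rel van C0 pairs = go
  where
  C1≡C2 : C 1 ≡ C 2
  C1≡C2 = begin
    C 1        ≡⟨ QP.+-identityˡ (C 1) ⟨
    0ℚ + C 1   ≡⟨ cong (_+ C 1) C0 ⟨
    C 0 + C 1  ≡⟨ lincomb≡0⇒sum≡next C 0 (rel 0 (s≤s z≤n)) ⟩
    C 2        ∎
    where open ≡-Reasoning
  pair₀ : C 1 ≡ 0ℚ × C 2 ≡ 0ℚ
  pair₀ = equal⇒both-zero C1≡C2 (pairs 0 (s≤s z≤n))
  go : ∀ p → C p ≡ 0ℚ
  go 0             = C0
  go 1             = proj₁ pair₀
  go (suc (suc p)) = relation-vanishes-upward n (C ∘ suc ∘ suc) (λ j lt → rel (suc j) (s≤s lt))
                       (λ q le → van _ (s≤s (s≤s le))) (proj₂ pair₀) (λ j lt → pairs (suc j) (s≤s lt)) p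

-- Going down: C(2j+2) = 0 and coordinate j force C(2j) = -C(2j+1), so both vanish.
relation-vanishes-downward : ∀ n C → Relationℕ n C → VanishesFrom (double n) C →
  (∀ j → j < n → C (double j) ≡ 0ℚ ⊎ C (suc (double j)) ≡ 0ℚ) → ∀ p → C p ≡ 0ℚ
relation-vanishes-downward zero    C rel van pairs p = van p z≤n
relation-vanishes-downward (suc n) C rel van pairs = go
  where
  shifted : ∀ p → C (suc (suc p)) ≡ 0ℚ
  shifted = relation-vanishes-downward n (C ∘ suc ∘ suc) (λ j lt → rel (suc j) (s≤s lt))
              (λ q le → van _ (s≤s (s≤s le))) (λ j lt → pairs (suc j) (s≤s lt))
  pair₀ : C 0 ≡ 0ℚ × C 1 ≡ 0ℚ
  pair₀ = sum-zero⇒both-zero (trans (lincomb≡0⇒sum≡next C 0 (rel 0 (s≤s z≤n))) (shifted 0))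
                             (pairs 0 (s≤s z≤n))
  go : ∀ p → C p ≡ 0ℚ
  go 0             = proj₁ pair₀
  go 1             = proj₂ pair₀
  go (suc (suc p)) = shifted p

¬LinIndepℕ-spanned-extension : ∀ {n Q Q′} K →
  Spansℕ n Q → (∀ p → Q p → Q′ p) → Q′ K → ¬ Q K → ¬ LinIndepℕ n Q′
¬LinIndepℕ-spanned-extension {n} {Q′ = Q′} K sp Q⊆Q′ Q′K ¬QK li with sp (lincomb (λ p → δ p K))
... | G , sup , eq = 0-1≢0 (begin
  0ℚ - 1ℚ         ≡⟨ cong₂ _-_ (sup K ¬QK) (δ-refl K) ⟨
  G K - δ K K     ≡⟨ li (λ p → G p - δ p K) diff-supported diff-relation K ⟩
  0ℚ              ∎)
  where
  open ≡-Reasoning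
  0-1≢0 : 0ℚ - 1ℚ ≢ 0ℚ
  0-1≢0 ()
  diff-supported : Supportedℕ Q′ (λ p → G p - δ p K)
  diff-supported p ¬Q′p =
    cong₂ _-_ (sup p (¬Q′p ∘ Q⊆Q′ p)) (δ-≢ (λ p≡K → ¬Q′p (subst Q′ (sym p≡K) Q′K)))
  diff-relation : ∀ j → j < n → lincomb (λ p → G p - δ p K) j ≡ 0ℚ
  diff-relation j lt = trans (lincomb-sub G (λ p → δ p K) j)
    (trans (cong (_- lincomb (λ p → δ p K) j) (eq j lt)) (QP.+-inverseʳ (lincomb (λ p → δ p K) j)))

¬Spansℕ-missing-coordinate : ∀ {n Q} j → j < n →
  ¬ Q (double j) → ¬ Q (suc (double j)) → ¬ Q (suc (suc (double j))) → ¬ Spansℕ n Q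
¬Spansℕ-missing-coordinate j lt ¬a ¬b ¬c sp with sp (λ i → δ i j)
... | G , sup , eq = 0≢1 (trans (sym (lincomb-G≡0)) (trans (eq j lt) (δ-refl j)))
  where
  0≢1 : (0ℚ + 0ℚ) - 0ℚ ≢ 1ℚ
  0≢1 ()
  lincomb-G≡0 : lincomb G j ≡ (0ℚ + 0ℚ) - 0ℚ
  lincomb-G≡0 = cong₂ _-_ (cong₂ _+_ (sup _ ¬a) (sup _ ¬b)) (sup _ ¬c)

Spansℕ-mono : ∀ {n Q Q′} → (∀ p → Q p → Q′ p) → Spansℕ n Q → Spansℕ n Q′
Spansℕ-mono Q⊆Q′ sp v with sp v
... | G , sup , eq = G , (λ p ¬Q′p → sup p (¬Q′p ∘ Q⊆Q′ p)) , eq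

Spansℕ-exchange : ∀ {n Q Q′} (R : ℕ → ℚ) K → (∀ j → lincomb R j ≡ 0ℚ) → R K ≡ 1ℚ →
  (∀ p → p ≢ K → Q p → Q′ p) → (∀ p → p ≢ K → ¬ Q′ p → R p ≡ 0ℚ) →
  Spansℕ n Q → Spansℕ n Q′
Spansℕ-exchange {n} {Q′ = Q′} R K rel RK≡1 Q⊆Q′ R-sup sp v with sp v
... | G , sup , eq = G′ , sup′ , eq′
  where
  G′ : ℕ → ℚ
  G′ p = G p - G K * R p
  sup′ : Supportedℕ Q′ G′
  sup′ p ¬Q′p with p N.≟ K
  ... | yes refl = trans (cong (λ r → G K - G K * r) RK≡1)
                         (solve 1 (λ g → g :- g :* con 1ℚ := con 0ℚ) refl (G K))
  ... | no p≢K   = trans (cong₂ (λ a r → a - G K * r) (sup p (¬Q′p ∘ Q⊆Q′ p p≢K))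
                                                      (R-sup p p≢K ¬Q′p))
                         (solve 1 (λ g → con 0ℚ :- g :* con 0ℚ := con 0ℚ) refl (G K))
  eq′ : ∀ j → j < n → lincomb G′ j ≡ v j
  eq′ j lt = trans (lincomb-sub-scaled G R (G K) j)
               (trans (cong₂ (λ a r → a - G K * r) (eq j lt) (rel j))
                      (solve 2 (λ a g → a :- g :* con 0ℚ := a) refl (v j) (G K)))

spans-one-per-pair : ∀ n f → OnePerPair n f → Spansℕ n (λ p → f p ≡ true)
spans-one-per-pair zero    f pairs v = (λ _ → 0ℚ) , (λ _ _ → refl) , (λ _ ())
spans-one-per-pair (suc n) f pairs v
  with spans-one-per-pair n (f ∘ suc ∘ suc) (λ j lt → pairs (suc j) (s≤s lt)) (v ∘ suc)
... | G′ , sup′ , eq′ = G , sup , eq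
  where
  w : ℚ
  w = v 0 + G′ 0
  G : ℕ → ℚ
  G 0             = if f 0 then w else 0ℚ
  G 1             = if f 1 then w else 0ℚ
  G (suc (suc p)) = G′ p
  sup : Supportedℕ (λ p → f p ≡ true) G
  sup 0             ¬f0 = if-cong (¬-not ¬f0)
  sup 1             ¬f1 = if-cong (¬-not ¬f1)
  sup (suc (suc p))     = sup′ p
  pair-total : ∀ a b → a ≡ not b → (if a then w else 0ℚ) + (if b then w else 0ℚ) ≡ w
  pair-total true  false _ = QP.+-identityʳ w
  pair-total false true  _ = QP.+-identityˡ w
  eq : ∀ j → j < suc n → lincomb G j ≡ v j
  eq 0       _        = trans (cong (_- G′ 0) (pair-total (f 0) (f 1) (pairs 0 (s≤s z≤n))))
                          (solve 2 (λ a b → (a :+ b) :- b := a) refl (v 0) (G′ 0))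
  eq (suc j) (s≤s lt) = eq′ j lt

interleave : (ℕ → ℚ) → (ℕ → ℚ) → ℕ → ℚ
interleave A B zero          = A 0
interleave A B (suc zero)    = B 0
interleave A B (suc (suc p)) = interleave (A ∘ suc) (B ∘ suc) p

interleave-even : ∀ A B j → interleave A B (double j) ≡ A j
interleave-even A B zero    = refl
interleave-even A B (suc j) = interleave-even (A ∘ suc) (B ∘ suc) j

interleave-odd : ∀ A B j → interleave A B (suc (double j)) ≡ B j
interleave-odd A B zero    = refl
interleave-odd A B (suc j) = interleave-odd (A ∘ suc) (B ∘ suc) j

odd-pair-coordinate : ∀ a b → a ≡ not b → ∀ r w →
  (r + (if a then w - r else 0ℚ)) - (if b then r - w else 0ℚ) ≡ w
odd-pair-coordinate true  false _ = solve 2 (λ r w → (r :+ (w :- r)) :- con 0ℚ := w) refl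
odd-pair-coordinate false true  _ = solve 2 (λ r w → (r :+ con 0ℚ) :- (r :- w) := w) refl

spans-one-per-odd-pair : ∀ n f → OnePerPair n (f ∘ suc) → Spansℕ n (λ p → f p ≡ true)
spans-one-per-odd-pair n f pairs v = interleave R O , sup , eq
  where
  R : ℕ → ℚ
  R zero    = 0ℚ
  R (suc j) = if f (suc (suc (double j))) then R j - v j else 0ℚ
  O : ℕ → ℚ
  O j = if f (suc (double j)) then v j - R j else 0ℚ
  sup : Supportedℕ (λ p → f p ≡ true) (interleave R O)
  sup p ¬fp with parity p
  ... | even zero    = refl
  ... | even (suc j) = trans (interleave-even R O (suc j)) (if-cong (¬-not ¬fp))
  ... | odd j        = trans (interleave-odd R O j) (if-cong (¬-not ¬fp))
  eq : ∀ j → j < n → lincomb (interleave R O) j ≡ v j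
  eq j lt = trans (cong₂ _-_ (cong₂ _+_ (interleave-even R O j) (interleave-odd R O j))
                              (interleave-even R O (suc j)))
                  (odd-pair-coordinate _ _ (pairs j lt) (R j) (v j))

relation₁₂ : ℕ → ℚ
relation₁₂ p = δ p 0 - δ p 1

relation₁₂-lincomb : ∀ j → lincomb relation₁₂ j ≡ 0ℚ
relation₁₂-lincomb zero    = refl
relation₁₂-lincomb (suc j) = refl

-- x_{2j+2} + x_{2j+3} - x_{2j+4} = e_{j+1} + (e_{j+2} - e_{j+1}) - e_{j+2} = 0.
relation-odd : ℕ → ℕ → ℚ
relation-odd j p = (δ p (suc (double j)) + δ p (suc (suc (double j)))) - δ p (suc (suc (suc (double j))))

relation-odd-lincomb : ∀ j i → lincomb (relation-odd j) i ≡ 0ℚ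
relation-odd-lincomb zero    zero          = refl
relation-odd-lincomb zero    (suc zero)    = refl
relation-odd-lincomb zero    (suc (suc i)) = refl
relation-odd-lincomb (suc j) zero          = refl
relation-odd-lincomb (suc j) (suc i)       = relation-odd-lincomb j i

relation-odd-at : ∀ j → relation-odd j (suc (double j)) ≡ 1ℚ
relation-odd-at zero    = refl
relation-odd-at (suc j) = relation-odd-at j

relation-odd-top : ∀ j → relation-odd j (suc (suc (suc (double j)))) ≡ (0ℚ + 0ℚ) - 1ℚ
relation-odd-top zero    = refl
relation-odd-top (suc j) = relation-odd-top j

relation-odd-outside : ∀ j p →
  p ≢ suc (double j) → p ≢ suc (suc (double j)) → p ≢ suc (suc (suc (double j))) → relation-odd j p ≡ 0ℚ
relation-odd-outside j p ne₁ ne₂ ne₃ rewrite δ-≢ ne₁ | δ-≢ ne₂ | δ-≢ ne₃ = refl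

-- Maximal and internal bases in terms of positions

record Basisℕ (n : ℕ) (f : ℕ → Bool) : Set where
  field
    card        : count f (double n) ≡ n
    independent : LinIndepℕ n (λ p → f p ≡ true)
    spanning    : Spansℕ n (λ p → f p ≡ true)

ValFamily : (ℕ → Bool) → ℕ → ℕ → Set
ValFamily f K p = p ≡ K ⊎ (f p ≡ true × p < K)

StarFamily : ℕ → (ℕ → Bool) → ℕ → ℕ → Set
StarFamily n f K p = (f p ≡ true × p ≢ K) ⊎ (f p ≡ false × K < p × p < double n)

Maximalℕ Internalℕ : ℕ → (ℕ → Bool) → Set
Maximalℕ n f = ∀ K → K < double n → f K ≡ false → LinIndepℕ n (ValFamily f K)
Internalℕ n f = ∀ K → f K ≡ true → Spansℕ n (StarFamily n f K)

record MaxShape (n′ : ℕ) (f : ℕ → Bool) : Set where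
  field
    first-out : f 0 ≡ false
    pairs     : OnePerPair n′ (f ∘ suc)
    last-in   : f (suc (double n′)) ≡ true

record IntShape (n′ : ℕ) (f : ℕ → Bool) : Set where
  field
    pairs    : OnePerPair (suc n′) f
    last-out : f (suc (double n′)) ≡ false

module Shapes (n′ : ℕ) (f : ℕ → Bool) (bounded : ∀ p → double (suc n′) ≤ p → f p ≡ false) where

  private
    n : ℕ
    n = suc n′

  module _ (shape : MaxShape n′ f) where
    open MaxShape shape

    private
      odd-pairs : OnePerPair n (f ∘ suc)
      odd-pairs = OnePerPair-snoc {f = f ∘ suc} pairs (trans last-in (cong not (sym (bounded _ NP.≤-refl))))

    maxShape⇒basis : Basisℕ n f
    maxShape⇒basis = record
      { card        = card
      ; independent = λ C sup rel → relation-vanishes-upward n C rel (λ p le → sup p (not-¬ (bounded p le)))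
                        (sup 0 (not-¬ first-out)) (λ j lt → one-of-pair-zero sup (odd-pairs j lt))
      ; spanning    = spans-one-per-odd-pair n f odd-pairs
      }
      where
      card : count f (double n) ≡ n
      card = begin
        count f (double n)                   ≡⟨ if-cong first-out ⟩
        count (f ∘ suc) (suc (double n′))    ≡⟨ count-last (f ∘ suc) _ last-in ⟩
        suc (count (f ∘ suc) (double n′))    ≡⟨ cong suc (count-one-per-pair n′ _ pairs) ⟩
        n                                    ∎
        where open ≡-Reasoning

    maxShape⇒maximal : Maximalℕ n f
    maxShape⇒maximal K K<2n _ C sup rel = relation-vanishes-upward n C rel van C0 pairs′
      where
      above : ∀ p → K < p → C p ≡ 0ℚ
      above p K<p = sup p λ { (inj₁ refl) → NP.<-irrefl refl K<p ; (inj₂ (_ , p<K)) → NP.<-asym p<K K<p }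
      outside : ∀ p → f p ≡ false → p ≢ K → C p ≡ 0ℚ
      outside p fp p≢K = sup p λ { (inj₁ p≡K) → p≢K p≡K ; (inj₂ (fp′ , _)) → not-¬ fp fp′ }
      van : ∀ p → double n ≤ p → C p ≡ 0ℚ
      van p le = above p (NP.<-≤-trans K<2n le)
      C0 : C 0 ≡ 0ℚ
      C0 with K N.≟ 0
      ... | yes refl = lincomb≡0⇒first≡0 C 0 (rel 0 (s≤s z≤n)) (above 1 (s≤s z≤n)) (above 2 (s≤s z≤n))
      ... | no K≢0   = outside 0 first-out (K≢0 ∘ sym)
      pairs′ : ∀ j → j < n → C (suc (double j)) ≡ 0ℚ ⊎ C (suc (suc (double j))) ≡ 0ℚ
      pairs′ j lt with f (suc (double j)) in e | suc (double j) N.≟ K | suc (suc (double j)) N.≟ K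
      ... | false | yes refl | _        = inj₂ (above _ (NP.n<1+n _))
      ... | false | no ne    | _        = inj₁ (outside _ e ne)
      ... | true  | _        | no ne    = inj₂ (outside _ (not-swap (trans (sym e) (odd-pairs j lt))) ne)
      ... | true  | _        | yes refl =
        inj₂ (lincomb≡0⇒first≡0 C (suc j) (rel (suc j) (double-cancel-< K<2n))
                (above _ (NP.n<1+n _)) (above _ (s≤s (NP.n≤1+n _))))

  module _ (basis : Basisℕ n f) (maximal : Maximalℕ n f) where
    open Basisℕ basis

    private
      no-relation-below : ∀ R c → c < double n → (∀ j → lincomb R j ≡ 0ℚ) → R c ≢ 0ℚ →
        Supportedℕ (ValFamily f c) R → ⊥
      no-relation-below R c c<2n rel Rc≢0 sup with f c in fc
      ... | true  = Rc≢0 (independent R sup′ (λ j _ → rel j) c)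
        where
        sup′ : Supportedℕ (λ p → f p ≡ true) R
        sup′ p ¬fp = sup p λ { (inj₁ refl) → ¬fp fc ; (inj₂ (fp , _)) → ¬fp fp }
      ... | false = Rc≢0 (maximal c c<2n fc R sup (λ j _ → rel j) c)

      first-out : f 0 ≡ false
      first-out = ¬-not λ f0 →
        no-relation-below relation₁₂ 1 (s≤s (s≤s z≤n)) relation₁₂-lincomb (λ ()) (sup f0)
        where
        sup : f 0 ≡ true → Supportedℕ (ValFamily f 1) relation₁₂
        sup f0 0             ¬V = ⊥-elim (¬V (inj₂ (f0 , s≤s z≤n)))
        sup f0 1             ¬V = ⊥-elim (¬V (inj₁ refl))
        sup f0 (suc (suc p)) _  = refl

      last-in : f (suc (double n′)) ≡ true
      last-in with f (suc (double n′)) in e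
      ... | true  = refl
      ... | false = ⊥-elim (¬LinIndepℕ-spanned-extension K spanning f⊆V (inj₁ refl) (not-¬ e)
                                                           (maximal K (NP.n<1+n K) e))
        where
        K = suc (double n′)
        f⊆V : ∀ p → f p ≡ true → ValFamily f K p
        f⊆V p fp = inj₂ (fp , NP.≤∧≢⇒< (NP.≤-pred (true⇒< bounded fp)) (λ { refl → not-¬ e fp }))

      at-most-one : AtMostOnePerPair n′ (f ∘ suc)
      at-most-one j lt fa with f (suc (suc (double j))) in fb
      ... | false = refl
      ... | true  = ⊥-elim (no-relation-below (relation-odd j) c (suc-double<double {suc j} (s≤s lt))
                      (relation-odd-lincomb j) (λ eq → top≢0 (trans (sym (relation-odd-top j)) eq)) sup)
        where
        top≢0 : (0ℚ + 0ℚ) - 1ℚ ≢ 0ℚ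
        top≢0 ()
        c = suc (suc (suc (double j)))
        sup : Supportedℕ (ValFamily f c) (relation-odd j)
        sup p ¬V = relation-odd-outside j p
                     (λ { refl → ¬V (inj₂ (fa , NP.≤-trans (NP.n<1+n _) (NP.n≤1+n _))) })
                     (λ { refl → ¬V (inj₂ (fb , NP.n<1+n _)) })
                     (λ { refl → ¬V (inj₁ refl) })

    basis-maximal⇒maxShape : MaxShape n′ f
    basis-maximal⇒maxShape = record
      { first-out = first-out
      ; pairs     = count-≤-tight n′ (f ∘ suc) at-most-one (NP.suc-injective (begin
          suc (count (f ∘ suc) (double n′))  ≡⟨ count-last (f ∘ suc) _ last-in ⟨
          count (f ∘ suc) (suc (double n′))  ≡⟨ if-cong first-out ⟨
          count f (double n)                 ≡⟨ card ⟩
          n                                  ∎))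
      ; last-in   = last-in
      }
      where open ≡-Reasoning

  module _ (shape : IntShape n′ f) where
    open IntShape shape

    intShape⇒basis : Basisℕ n f
    intShape⇒basis = record
      { card        = count-one-per-pair n f pairs
      ; independent = λ C sup rel → relation-vanishes-downward n C rel (λ p le → sup p (not-¬ (bounded p le)))
                        (λ j lt → one-of-pair-zero sup (pairs j lt))
      ; spanning    = spans-one-per-pair n f pairs
      }

    private
      star-above : ∀ {K p} → K < p → p < double n → StarFamily n f K p
      star-above {p = p} K<p p<2n with f p
      ... | true  = inj₁ (refl , λ { refl → NP.<-irrefl refl K<p })
      ... | false = inj₂ (refl , K<p , p<2n)

    -- For x_{2j+1} ∈ B flip the pair {2j, 2j+1}; for x_{2j+2} ∈ B use x_{2j+2} = x_{2j+4} - x_{2j+3}.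
    intShape⇒internal : Internalℕ n f
    intShape⇒internal K fK with parity K
    ... | even j =
      Spansℕ-mono flip⊆star (spans-one-per-pair n (flipPair j f) (OnePerPair-flipPair {f = f} j pairs))
      where
      flip⊆star : ∀ p → flipPair j f p ≡ true → StarFamily n f (double j) p
      flip⊆star p fp with ⌊ p /2⌋ ≡ᵇ j in e
      ... | false = inj₁ (fp , λ { refl → subst T e (NP.≡⇒≡ᵇ _ _ (⌊double/2⌋ j)) })
      ... | true with ⌊/2⌋≡⇒ {p} {j} (NP.≡ᵇ⇒≡ ⌊ p /2⌋ j (subst T (sym e) tt))
      ...   | inj₁ refl = contradiction fK (not-¬ (not-injective fp))
      ...   | inj₂ refl =
        inj₂ (not-injective fp , NP.n<1+n _ , suc-double<double (double-cancel-< (true⇒< bounded fK)))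
    ... | odd j = Spansℕ-exchange (relation-odd j) K (relation-odd-lincomb j) (relation-odd-at j)
                    (λ p p≢K fp → inj₁ (fp , p≢K)) relation-outside (spans-one-per-pair n f pairs)
      where
      j<n′ : j < n′
      j<n′ = NP.≤∧≢⇒< (NP.≤-pred (double-cancel-< (NP.<-trans (NP.n<1+n _) (true⇒< bounded fK))))
                       (λ { refl → not-¬ last-out fK })
      3+2j<2n : suc (suc (suc (double j))) < double n
      3+2j<2n = suc-double<double {suc j} (s≤s j<n′)
      relation-outside : ∀ p → p ≢ K → ¬ StarFamily n f K p → relation-odd j p ≡ 0ℚ
      relation-outside p p≢K ¬S = relation-odd-outside j p p≢K
        (λ { refl → ¬S (star-above (NP.n<1+n _) (NP.<-trans (NP.n<1+n _) 3+2j<2n)) })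
        (λ { refl → ¬S (star-above (s≤s (NP.n≤1+n _)) 3+2j<2n) })

  module _ (basis : Basisℕ n f) (internal : Internalℕ n f) where
    open Basisℕ basis

    private
      ¬star-self : ∀ {K} → ¬ StarFamily n f K K
      ¬star-self (inj₁ (_ , K≢K))    = K≢K refl
      ¬star-self (inj₂ (_ , K<K , _)) = NP.<-irrefl refl K<K

      ¬star-below : ∀ {K p} → p < K → f p ≡ false → ¬ StarFamily n f K p
      ¬star-below p<K fp (inj₁ (fp′ , _))    = not-¬ fp fp′
      ¬star-below p<K fp (inj₂ (_ , K<p , _)) = NP.<-asym p<K K<p

      last-out : f (suc (double n′)) ≡ false
      last-out = ¬-not λ fK → ¬LinIndepℕ-spanned-extension K (internal K fK) star⊆f fK ¬star-self independent
        where
        K = suc (double n′)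
        star⊆f : ∀ p → StarFamily n f K p → f p ≡ true
        star⊆f p (inj₁ (fp , _))          = fp
        star⊆f p (inj₂ (_ , K<p , p<2n)) = ⊥-elim (NP.<⇒≱ K<p (NP.≤-pred p<2n))

      -- Downwards from the last pair: if pair j is empty, the first element of B after it
      -- (x_{2j+3}, or else x_{2j+4}) has a val*-family missing coordinate j.
      at-least-one-from : ∀ d j → j N.+ d ≡ n′ → f (double j) ≡ false → f (suc (double j)) ≡ true
      at-least-one-from d j j+d≡n′ f₀ with f (suc (double j)) in f₁
      ... | true  = refl
      ... | false = ⊥-elim (missing d j+d≡n′)
        where
        j<n : j < n
        j<n = s≤s (subst (j ≤_) j+d≡n′ (NP.m≤m+n j d))
        missing : ∀ d → j N.+ d ≡ n′ → ⊥
        missing zero    j+0≡n′ =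
          ¬Spansℕ-missing-coordinate j j<n (not-¬ f₀) (not-¬ f₁) (not-¬ (bounded _ top)) spanning
          where top = NP.≤-reflexive (cong (double ∘ suc) (trans (sym j+0≡n′) (NP.+-identityʳ j)))
        missing (suc d) j+d≡n′ with f (double (suc j)) in f₂
        ... | true  = ¬Spansℕ-missing-coordinate {Q = StarFamily n f K} j j<n
                        (¬star-below {K} (s≤s (NP.n≤1+n _)) f₀) (¬star-below {K} (NP.n<1+n _) f₁) ¬star-self
                        (internal K f₂)
          where K = double (suc j)
        ... | false = ¬Spansℕ-missing-coordinate {Q = StarFamily n f K} j j<n
                        (¬star-below {K} (s≤s (NP.≤-trans (NP.n≤1+n _) (NP.n≤1+n _))) f₀)
                        (¬star-below {K} (s≤s (s≤s (NP.n≤1+n _))) f₁) (¬star-below {K} (NP.n<1+n _) f₂)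
                        (internal K (at-least-one-from d (suc j) (trans (sym (NP.+-suc j d)) j+d≡n′) f₂))
          where K = suc (double (suc j))

    basis-internal⇒intShape : IntShape n′ f
    basis-internal⇒intShape = record
      { pairs    = count-≥-tight n f
                     (λ j lt → at-least-one-from (n′ ∸ j) j (NP.m+[n∸m]≡n (NP.≤-pred lt))) card
      ; last-out = last-out
      }

-- The sets described by MaxForm and IntForm, as predicates on the paper's (1-based) indices.
InMaxForm InIntForm : ℕ → (ℕ → Bool) → ℕ → Set
InMaxForm n s q =
  q ≡ 2 N.* n ⊎ Σ ℕ λ i → 1 ≤ i × i ≤ n ∸ 1 × q ≡ (if s i then 2 N.* i else suc (2 N.* i))
InIntForm n s q =
  q ≡ 2 N.* n ∸ 1 ⊎ Σ ℕ λ i → 1 ≤ i × i ≤ n ∸ 1 × q ≡ (if s i then 2 N.* i ∸ 1 else 2 N.* i)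

module _ {n′ : ℕ} {s : ℕ → Bool} where

  ¬InMaxForm-1 : ¬ InMaxForm (suc n′) s 1
  ¬InMaxForm-1 (inj₁ e) with trans e (2*≡double (suc n′))
  ... | ()
  ¬InMaxForm-1 (inj₂ (suc i , _ , _ , e)) with s (suc i)
  ... | true  = double≢suc-double (sym (trans e (2*≡double (suc i))))
  ... | false with NP.suc-injective (trans e (cong suc (2*≡double (suc i))))
  ...   | ()

  InMaxForm-even : ∀ j → InMaxForm (suc n′) s (double (suc j)) ⇔ (j ≡ n′ ⊎ (j < n′ × s (suc j) ≡ true))
  InMaxForm-even j = mk⇔ to from
    where
    to : InMaxForm (suc n′) s (double (suc j)) → j ≡ n′ ⊎ (j < n′ × s (suc j) ≡ true)
    to (inj₁ e) = inj₁ (NP.suc-injective (double-injective (trans e (2*≡double (suc n′)))))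
    to (inj₂ (suc i , _ , i≤n′ , e)) with s (suc i) in si
    ... | true  with double-injective (trans e (2*≡double (suc i)))
    ...   | refl = inj₂ (i≤n′ , si)
    to (inj₂ (suc i , _ , i≤n′ , e)) | false =
      ⊥-elim (double≢suc-double (trans e (cong suc (2*≡double (suc i)))))
    from : j ≡ n′ ⊎ (j < n′ × s (suc j) ≡ true) → InMaxForm (suc n′) s (double (suc j))
    from (inj₁ refl)      = inj₁ (sym (2*≡double (suc j)))
    from (inj₂ (lt , sj)) = inj₂ (suc j , s≤s z≤n , lt , sym (trans (if-cong sj) (2*≡double (suc j))))

  InMaxForm-odd : ∀ j → InMaxForm (suc n′) s (suc (double (suc j))) ⇔ (j < n′ × s (suc j) ≡ false)
  InMaxForm-odd j = mk⇔ to from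
    where
    to : InMaxForm (suc n′) s (suc (double (suc j))) → j < n′ × s (suc j) ≡ false
    to (inj₁ e) = ⊥-elim (double≢suc-double (sym (trans e (2*≡double (suc n′)))))
    to (inj₂ (suc i , _ , i≤n′ , e)) with s (suc i) in si
    ... | true  = ⊥-elim (double≢suc-double (sym (trans e (2*≡double (suc i)))))
    ... | false with double-injective (NP.suc-injective (trans e (cong suc (2*≡double (suc i)))))
    ...   | refl = i≤n′ , si
    from : j < n′ × s (suc j) ≡ false → InMaxForm (suc n′) s (suc (double (suc j)))
    from (lt , sj) = inj₂ (suc j , s≤s z≤n , lt , sym (trans (if-cong sj) (cong suc (2*≡double (suc j)))))

  InIntForm⇔InMaxForm : ∀ q → InIntForm (suc n′) s (suc q) ⇔ InMaxForm (suc n′) s (suc (suc q))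
  InIntForm⇔InMaxForm q = mk⇔ to from
    where
    to : InIntForm (suc n′) s (suc q) → InMaxForm (suc n′) s (suc (suc q))
    to (inj₁ e) =
      inj₁ (trans (cong suc (trans e (cong (_∸ 1) (2*≡double (suc n′))))) (sym (2*≡double (suc n′))))
    to (inj₂ (suc i , o , le , e)) with s (suc i) in si
    ... | true  = inj₂ (suc i , o , le , trans (cong suc (trans e (cong (_∸ 1) (2*≡double (suc i)))))
                                               (sym (trans (if-cong si) (2*≡double (suc i)))))
    ... | false = inj₂ (suc i , o , le , trans (cong suc e) (sym (if-cong si)))
    from : InMaxForm (suc n′) s (suc (suc q)) → InIntForm (suc n′) s (suc q)
    from (inj₁ e) =
      inj₁ (trans (NP.suc-injective (trans e (2*≡double (suc n′)))) (sym (cong (_∸ 1) (2*≡double (suc n′)))))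
    from (inj₂ (suc i , o , le , e)) with s (suc i) in si
    ... | true  = inj₂ (suc i , o , le , trans (NP.suc-injective (trans e (2*≡double (suc i))))
                                               (sym (trans (if-cong si) (cong (_∸ 1) (2*≡double (suc i))))))
    ... | false = inj₂ (suc i , o , le , trans (NP.suc-injective e) (sym (if-cong si)))

Describes : ℕ → (ℕ → Bool) → (ℕ → Set) → Set
Describes n f X = ∀ p → p < double n → (f p ≡ true) ⇔ X p

module _ {n′ : ℕ} {f : ℕ → Bool} where

  private
    n : ℕ
    n = suc n′

    adjoin-first : ∀ {j b} → j < n′ → (b ≡ true) ⇔ (j ≡ n′ ⊎ (j < n′ × b ≡ true))
    adjoin-first j<n′ = mk⇔ (λ b≡true → inj₂ (j<n′ , b≡true))
                            (λ { (inj₁ refl)         → ⊥-elim (NP.<-irrefl refl j<n′)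
                               ; (inj₂ (_ , b≡true)) → b≡true })

    adjoin-second : ∀ {j b} → j < n′ → (b ≡ false) ⇔ (j < n′ × b ≡ false)
    adjoin-second j<n′ = mk⇔ (j<n′ ,_) proj₂

    last-or-before : ∀ {j} → j < n → j ≡ n′ ⊎ j < n′
    last-or-before lt with NP.m≤n⇒m<n∨m≡n (NP.≤-pred lt)
    ... | inj₁ j<n′ = inj₂ j<n′
    ... | inj₂ j≡n′ = inj₁ j≡n′

  MaxShape⇔MaxForm : MaxShape n′ f ⇔ Σ (ℕ → Bool) λ s → Describes n f (InMaxForm n s ∘ suc)
  MaxShape⇔MaxForm = mk⇔ to from
    where
    to : MaxShape n′ f → Σ (ℕ → Bool) λ s → Describes n f (InMaxForm n s ∘ suc)
    to shape = s , describe
      where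
      open MaxShape shape
      s : ℕ → Bool
      s i = f (double i ∸ 1)
      describe : Describes n f (InMaxForm n s ∘ suc)
      describe p lt with parity p
      ... | even zero    = mk⇔ (λ f0 → contradiction f0 (not-¬ first-out)) (⊥-elim ∘ ¬InMaxForm-1)
      ... | even (suc j) = ⇔.trans (≡not⇒⇔ (not-swap (pairs j j<n′)))
                             (⇔.trans (adjoin-second j<n′) (⇔.sym (InMaxForm-odd j)))
        where j<n′ = NP.≤-pred (double-cancel-< lt)
      ... | odd j with last-or-before (double-cancel-< (NP.<-trans (NP.n<1+n _) lt))
      ...   | inj₁ refl = mk⇔ (λ _ → Equivalence.from (InMaxForm-even j) (inj₁ refl)) (λ _ → last-in)
      ...   | inj₂ j<n′ = ⇔.trans (adjoin-first j<n′) (⇔.sym (InMaxForm-even j))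
    from : (Σ (ℕ → Bool) λ s → Describes n f (InMaxForm n s ∘ suc)) → MaxShape n′ f
    from (s , describe) = record
      { first-out = ¬-not λ f0 → ¬InMaxForm-1 (Equivalence.to (describe 0 (s≤s z≤n)) f0)
      ; pairs     = λ j lt → trans (odd-value j lt) (not-swap (even-value j lt))
      ; last-in   = Equivalence.from (describe _ (NP.n<1+n _)) (Equivalence.from (InMaxForm-even n′) (inj₁ refl))
      }
      where
      odd-value : ∀ j → j < n′ → f (suc (double j)) ≡ s (suc j)
      odd-value j lt = bool-ext (⇔.trans (describe _ (suc-double<double (s≤s (NP.<⇒≤ lt))))
                                 (⇔.trans (InMaxForm-even j) (⇔.sym (adjoin-first lt))))
      even-value : ∀ j → j < n′ → f (double (suc j)) ≡ not (s (suc j))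
      even-value j lt = bool-ext (⇔.trans (describe _ (NP.<-trans (NP.n<1+n _) (suc-double<double (s≤s lt))))
                                  (⇔.trans (InMaxForm-odd j)
                                           (⇔.trans (⇔.sym (adjoin-second lt)) (⇔.sym (≡not⇒⇔ refl)))))

  IntShape⇔IntForm : IntShape n′ f ⇔ Σ (ℕ → Bool) λ s → Describes n f (InIntForm n s ∘ suc)
  IntShape⇔IntForm = mk⇔ to from
    where
    InIntForm-first : ∀ {s} j → InIntForm n s (suc (double j)) ⇔ (j ≡ n′ ⊎ (j < n′ × s (suc j) ≡ true))
    InIntForm-first j = ⇔.trans (InIntForm⇔InMaxForm (double j)) (InMaxForm-even j)
    InIntForm-second : ∀ {s} j → InIntForm n s (suc (suc (double j))) ⇔ (j < n′ × s (suc j) ≡ false)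
    InIntForm-second j = ⇔.trans (InIntForm⇔InMaxForm (suc (double j))) (InMaxForm-odd j)
    to : IntShape n′ f → Σ (ℕ → Bool) λ s → Describes n f (InIntForm n s ∘ suc)
    to shape = s , describe
      where
      open IntShape shape
      s : ℕ → Bool
      s i = f (double i ∸ 2)
      describe : Describes n f (InIntForm n s ∘ suc)
      describe p lt with parity p
      ... | even j with last-or-before (double-cancel-< lt)
      ...   | inj₁ refl = mk⇔ (λ _ → Equivalence.from (InIntForm-first j) (inj₁ refl))
                              (λ _ → trans (pairs j (NP.n<1+n j)) (cong not last-out))
      ...   | inj₂ j<n′ = ⇔.trans (adjoin-first j<n′) (⇔.sym (InIntForm-first j))
      describe p lt | odd j with last-or-before (double-cancel-< (NP.<-trans (NP.n<1+n _) lt))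
      ...   | inj₁ refl = mk⇔ (λ fp → contradiction fp (not-¬ last-out))
                              (λ h → ⊥-elim (NP.<-irrefl refl (proj₁ (Equivalence.to (InIntForm-second j) h))))
      ...   | inj₂ j<n′ = ⇔.trans (≡not⇒⇔ (not-swap (pairs j (NP.m<n⇒m<1+n j<n′))))
                            (⇔.trans (adjoin-second j<n′) (⇔.sym (InIntForm-second j)))
    from : (Σ (ℕ → Bool) λ s → Describes n f (InIntForm n s ∘ suc)) → IntShape n′ f
    from (s , describe) = record
      { pairs    = pairs
      ; last-out = last-out
      }
      where
      last-out : f (suc (double n′)) ≡ false
      last-out = ¬-not λ fl → NP.<-irrefl refl (proj₁ (Equivalence.to (InIntForm-second n′)
                                                   (Equivalence.to (describe _ (NP.n<1+n _)) fl)))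
      pairs : OnePerPair n f
      pairs j lt with last-or-before lt
      ... | inj₁ refl = trans (Equivalence.from (describe _ (NP.<-trans (NP.n<1+n _) (NP.n<1+n _)))
                                (Equivalence.from (InIntForm-first j) (inj₁ refl))) (cong not (sym last-out))
      ... | inj₂ j<n′ = trans first-value (not-swap second-value)
        where
        first-value : f (double j) ≡ s (suc j)
        first-value = bool-ext (⇔.trans (describe _ (NP.<-trans (NP.n<1+n _) (suc-double<double lt)))
                                (⇔.trans (InIntForm-first j) (⇔.sym (adjoin-first j<n′))))
        second-value : f (suc (double j)) ≡ not (s (suc j))
        second-value = bool-ext (⇔.trans (describe _ (suc-double<double lt))
                                 (⇔.trans (InIntForm-second j)
                                          (⇔.trans (⇔.sym (adjoin-second j<n′)) (⇔.sym (≡not⇒⇔ refl)))))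

-- Subsets of X_n as sets of positions

member : ∀ {m} → Subset m → ℕ → Bool
member []      p       = false
member (b ∷ B) zero    = b
member (b ∷ B) (suc p) = member B p

member-lookup : ∀ {m} (B : Subset m) k → member B (toℕ k) ≡ lookup B k
member-lookup (b ∷ B) F.zero    = refl
member-lookup (b ∷ B) (F.suc k) = member-lookup B k

∈⇔member : ∀ {m} (B : Subset m) k → k ∈ B ⇔ member B (toℕ k) ≡ true
∈⇔member B k = mk⇔ (λ k∈B → trans (member-lookup B k) (VP.[]=⇒lookup k∈B))
                   (λ mk → VP.lookup⇒[]= k B (trans (sym (member-lookup B k)) mk))

∉⇔member : ∀ {m} (B : Subset m) k → k ∉ B ⇔ member B (toℕ k) ≡ false
∉⇔member B k = mk⇔ (λ k∉B → ¬-not (k∉B ∘ Equivalence.from (∈⇔member B k)))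
                   (λ mk k∈B → not-¬ mk (Equivalence.to (∈⇔member B k) k∈B))

member-≥ : ∀ {m} (B : Subset m) p → m ≤ p → member B p ≡ false
member-≥ []      p       _        = refl
member-≥ (b ∷ B) (suc p) (s≤s le) = member-≥ B p le

∣∣≡count-member : ∀ {m} (B : Subset m) → ∣ B ∣ ≡ count (member B) m
∣∣≡count-member []          = refl
∣∣≡count-member (true ∷ B)  = cong suc (∣∣≡count-member B)
∣∣≡count-member (false ∷ B) = ∣∣≡count-member B

HasCard-∣∣⇔⊇ : ∀ {m} (S : Subset m) (P : Fin m → Set) → (∀ k → P k → k ∈ S) →
  HasCard P ∣ S ∣ ⇔ (∀ k → k ∈ S → P k)
HasCard-∣∣⇔⊇ S P P⊆S = mk⇔ to from
  where
  to : HasCard P ∣ S ∣ → ∀ k → k ∈ S → P k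
  to (S′ , S′⇔P , card) k k∈S with k ∈? S′
  ... | yes k∈S′ = Equivalence.to (S′⇔P k) k∈S′
  ... | no  k∉S′ = ⊥-elim (NP.<-irrefl card (p⊂q⇒∣p∣<∣q∣ (S′⊆S , k , k∈S , k∉S′)))
    where
    S′⊆S : ∀ {x} → x ∈ S′ → x ∈ S
    S′⊆S {x} x∈S′ = P⊆S x (Equivalence.to (S′⇔P x) x∈S′)
  from : (∀ k → k ∈ S → P k) → HasCard P ∣ S ∣
  from S⊆P = S , (λ k → mk⇔ (S⊆P k) (P⊆S k)) , refl

module AsPositions (n : ℕ) (B : Subset (2 N.* n)) where

  private
    f : ℕ → Bool
    f = member B

  member-bounded : ∀ p → double n ≤ p → member B p ≡ false
  member-bounded p le = member-≥ B p (subst (_≤ p) (sym (2*≡double n)) le)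

  private
    toℕ<double : ∀ (k : Fin (2 N.* n)) → toℕ k < double n
    toℕ<double k = subst (toℕ k <_) (2*≡double n) (FP.toℕ<n k)

    member⇒< : ∀ {p} → f p ≡ true → p < double n
    member⇒< = true⇒< member-bounded

    fin : ∀ {K} → K < double n → ∃ λ (k : Fin (2 N.* n)) → toℕ k ≡ K
    fin lt = fromℕ< lt′ , FP.toℕ-fromℕ< lt′
      where lt′ = subst (_ <_) (sym (2*≡double n)) lt

  Form⇔Describes : ∀ (X : (ℕ → Bool) → ℕ → Set) →
    (Σ (ℕ → Bool) λ s → ∀ k → (k ∈ B) ⇔ X s (toℕ k)) ⇔
    (Σ (ℕ → Bool) λ s → Describes n f (X s))
  Form⇔Describes X = mk⇔
    (λ (s , h) → s , λ p lt → at (fin lt) h)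
    (λ (s , d) → s , λ k → ⇔.trans (∈⇔member B k) (d (toℕ k) (toℕ<double k)))
    where
    at : ∀ {s p} → (∃ λ k → toℕ k ≡ p) → (∀ k → (k ∈ B) ⇔ X s (toℕ k)) →
         (f p ≡ true) ⇔ X s p
    at (k , refl) h = ⇔.trans (⇔.sym (∈⇔member B k)) (h k)

  member-represents : Represents n (_∈ B) (λ p → f p ≡ true)
  member-represents = record { represents = ∈⇔member B ; bounded = λ p → member⇒< }

  val-represents : ∀ k → Represents n (λ k′ → k′ ≡ k ⊎ (k′ ∈ B × k′ ≺ k)) (ValFamily f (toℕ k))
  val-represents k = record
    { represents = λ k′ → mk⇔
        (λ { (inj₁ refl)        → inj₁ refl
           ; (inj₂ (k′∈B , lt)) → inj₂ (Equivalence.to (∈⇔member B k′) k′∈B , lt) })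
        (λ { (inj₁ eq)          → inj₁ (FP.toℕ-injective eq)
           ; (inj₂ (fk′ , lt))  → inj₂ (Equivalence.from (∈⇔member B k′) fk′ , lt) })
    ; bounded    = λ { p (inj₁ refl) → toℕ<double k ; p (inj₂ (_ , lt)) → NP.<-trans lt (toℕ<double k) }
    }

  star-represents : ∀ b →
    Represents n (λ k → (k ∈ B × k ≢ b) ⊎ (k ∉ B × b ≺ k)) (StarFamily n f (toℕ b))
  star-represents b = record
    { represents = λ k → mk⇔
        (λ { (inj₁ (k∈B , k≢b)) → inj₁ (Equivalence.to (∈⇔member B k) k∈B , k≢b ∘ FP.toℕ-injective)
           ; (inj₂ (k∉B , lt)) → inj₂ (Equivalence.to (∉⇔member B k) k∉B , lt , toℕ<double k) })
        (λ { (inj₁ (fk , ne)) → inj₁ (Equivalence.from (∈⇔member B k) fk , λ { refl → ne refl })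
           ; (inj₂ (fk , lt , _)) → inj₂ (Equivalence.from (∉⇔member B k) fk , lt) })
    ; bounded    = λ { p (inj₁ (fp , _)) → member⇒< fp ; p (inj₂ (_ , _ , lt)) → lt }
    }

  IsBasis⇔Basisℕ : IsBasis n B ⇔ Basisℕ n f
  IsBasis⇔Basisℕ = mk⇔
    (λ (card , li , sp) → record
      { card        = trans (sym card-count) card
      ; independent = Equivalence.to (LinIndep⇔LinIndepℕ member-represents) li
      ; spanning    = Equivalence.to (Spans⇔Spansℕ member-represents) sp
      })
    (λ basis → let open Basisℕ basis in
       trans card-count card , Equivalence.from (LinIndep⇔LinIndepℕ member-represents) independent ,
       Equivalence.from (Spans⇔Spansℕ member-represents) spanning)
    where
    card-count : ∣ B ∣ ≡ count f (double n)
    card-count = trans (∣∣≡count-member B) (cong (count f) (2*≡double n))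

  Maximal⇔Maximalℕ : IsBasis n B → Maximal n B ⇔ Maximalℕ n f
  Maximal⇔Maximalℕ (card , _) = mk⇔ to from
    where
    ∣∁B∣≡n : ∣ ∁ B ∣ ≡ n
    ∣∁B∣≡n = trans (∣∁p∣≡n∸∣p∣ B) (trans (cong (2 N.* n ∸_) card)
               (trans (NP.m+n∸m≡n n (n N.+ 0)) (NP.+-identityʳ n)))
    counted : HasCard (ValSet n B) ∣ ∁ B ∣ ⇔ (∀ k → k ∈ ∁ B → ValSet n B k)
    counted = HasCard-∣∣⇔⊇ (∁ B) (ValSet n B) (λ k → x∉p⇒x∈∁p ∘ proj₁)
    to : Maximal n B → Maximalℕ n f
    to mx K K<2n fK with fin K<2n
    ... | k , refl = Equivalence.to (LinIndep⇔LinIndepℕ (val-represents k))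
                       (proj₂ (Equivalence.to counted (subst (HasCard _) (sym ∣∁B∣≡n) mx) k
                                 (x∉p⇒x∈∁p (Equivalence.from (∉⇔member B k) fK))))
    from : Maximalℕ n f → Maximal n B
    from mx = subst (HasCard _) ∣∁B∣≡n (Equivalence.from counted λ k k∈∁B →
      let k∉B = x∈∁p⇒x∉p k∈∁B in
      k∉B , Equivalence.from (LinIndep⇔LinIndepℕ (val-represents k))
              (mx (toℕ k) (toℕ<double k) (Equivalence.to (∉⇔member B k) k∉B)))

  Internal⇔Internalℕ : IsBasis n B → Internal n B ⇔ Internalℕ n f
  Internal⇔Internalℕ (card , _) = mk⇔ to from
    where
    counted : HasCard (ValStarSet n B) ∣ B ∣ ⇔ (∀ k → k ∈ B → ValStarSet n B k)
    counted = HasCard-∣∣⇔⊇ B (ValStarSet n B) (λ k → proj₁)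
    to : Internal n B → Internalℕ n f
    to it K fK with fin (member⇒< fK)
    ... | k , refl = Equivalence.to (Spans⇔Spansℕ (star-represents k))
                       (proj₂ (Equivalence.to counted (subst (HasCard _) (sym card) it) k
                                 (Equivalence.from (∈⇔member B k) fK)))
    from : Internalℕ n f → Internal n B
    from it = subst (HasCard _) card (Equivalence.from counted λ k k∈B →
      k∈B , Equivalence.from (Spans⇔Spansℕ (star-represents k))
              (it (toℕ k) (Equivalence.to (∈⇔member B k) k∈B)))

module Characterisation (n′ : ℕ) (B : Subset (2 N.* suc n′)) where
  open AsPositions (suc n′) B
  open Shapes n′ (member B) member-bounded

  maximal⇔MaxShape : (IsBasis (suc n′) B × Maximal (suc n′) B) ⇔ MaxShape n′ (member B)
  maximal⇔MaxShape = mk⇔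
    (λ (basis , mx) → basis-maximal⇒maxShape (Equivalence.to IsBasis⇔Basisℕ basis)
                                              (Equivalence.to (Maximal⇔Maximalℕ basis) mx))
    (λ shape → let basis = Equivalence.from IsBasis⇔Basisℕ (maxShape⇒basis shape) in
               basis , Equivalence.from (Maximal⇔Maximalℕ basis) (maxShape⇒maximal shape))

  internal⇔IntShape : (IsBasis (suc n′) B × Internal (suc n′) B) ⇔ IntShape n′ (member B)
  internal⇔IntShape = mk⇔
    (λ (basis , it) → basis-internal⇒intShape (Equivalence.to IsBasis⇔Basisℕ basis)
                                               (Equivalence.to (Internal⇔Internalℕ basis) it))
    (λ shape → let basis = Equivalence.from IsBasis⇔Basisℕ (intShape⇒basis shape) in
               basis , Equivalence.from (Internal⇔Internalℕ basis) (intShape⇒internal shape))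

  MaxForm⇔MaxShape : MaxForm (suc n′) B ⇔ MaxShape n′ (member B)
  MaxForm⇔MaxShape = ⇔.trans (Form⇔Describes (λ s → InMaxForm (suc n′) s ∘ suc)) (⇔.sym MaxShape⇔MaxForm)

  IntForm⇔IntShape : IntForm (suc n′) B ⇔ IntShape n′ (member B)
  IntForm⇔IntShape = ⇔.trans (Form⇔Describes (λ s → InIntForm (suc n′) s ∘ suc)) (⇔.sym IntShape⇔IntForm)

corollary1 : (n : ℕ) → 1 ≤ n →
    (∀ (B : Subset (2 Data.Nat.* n)) → (IsBasis n B × Maximal n B) ⇔ MaxForm n B) ×
    (∀ (B : Subset (2 Data.Nat.* n)) → (IsBasis n B × Internal n B) ⇔ IntForm n B)
corollary1 (suc n′) _ =
  (λ B → let open Characterisation n′ B in ⇔.trans maximal⇔MaxShape (⇔.sym MaxForm⇔MaxShape)) ,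
  (λ B → let open Characterisation n′ B in ⇔.trans internal⇔IntShape (⇔.sym IntForm⇔IntShape))
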